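{- If $k$ is an even positive integer, then there exist infinitely many (pairwise non-isomorphic) finite, simple, connected, cubic, arc-transitive $k$-circulants.
   Context: A permutation group is semiregular if its only element fixing a point is the identity. For an integer $k\geq 1$, a graph is a $k$-circulant if its automorphism group contains a cyclic semiregular subgroup with exactly $k$ orbits on the vertices. A graph is cubic if every vertex has degree $3$, and arc-transitive if its automorphism group acts transitively on ordered pairs of adjacent vertices. -}

module Defs where

open import Data.Nat using (ℕ; suc)
open import Data.Fin using (Fin)
open import Data.Fin.Permutation using (Permutation; Permutation′; _⟨$⟩ʳ_)
open import Data.Bool using (Bool; true; false)
open import Data.List using (List; length; filter; allFin; []; _∷_)
open import Data.Product using (Σ; ∃; ∃-syntax; _×_; _,_)
open import Relation.Binary.PropositionalEquality using (_≡_)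
open import Relation.Nullary using (¬_)
open import Function using (_∘_)
open import Data.Bool using (T)
open import Relation.Nullary.Decidable using (Dec)
open import Data.Bool.Properties using (T?)

record Graph : Set where
  field
    n     : ℕ
    adj   : Fin n → Fin n → Bool
    sym   : ∀ u v → adj u v ≡ adj v u
    irref : ∀ v → adj v v ≡ false
open Graph public

data Walk (G : Graph) : Fin (n G) → Fin (n G) → Set where
  here : ∀ {u} → Walk G u u
  step : ∀ {u v w} → adj G u v ≡ true → Walk G v w → Walk G u w

Connected : Graph → Set
Connected G = ∀ u v → Walk G u v

neighbours : (G : Graph) → Fin (n G) → List (Fin (n G))
neighbours G v = filter (λ w → T? (adj G v w)) (allFin (n G))

Cubic : Graph → Set
Cubic G = ∀ v → length (neighbours G v) ≡ 3

IsIso : (G H : Graph) → Permutation (n G) (n H) → Set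
IsIso G H σ = ∀ u v → adj H (σ ⟨$⟩ʳ u) (σ ⟨$⟩ʳ v) ≡ adj G u v

Isomorphic : Graph → Graph → Set
Isomorphic G H = Σ (Permutation (n G) (n H)) (IsIso G H)

IsAut : (G : Graph) → Permutation′ (n G) → Set
IsAut G σ = IsIso G G σ

ArcTransitive : Graph → Set
ArcTransitive G =
  ∀ u v x y → adj G u v ≡ true → adj G x y ≡ true →
  Σ (Permutation′ (n G)) λ σ → IsAut G σ × (σ ⟨$⟩ʳ u ≡ x) × (σ ⟨$⟩ʳ v ≡ y)

iter : ∀ {A : Set} → (A → A) → ℕ → A → A
iter f 0 a = a
iter f (suc i) a = f (iter f i a)

-- the elements of the cyclic group ⟨ρ⟩ (finite) are exactly the powers ρ^i, i ∈ ℕ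
power : ∀ {m} → Permutation′ m → ℕ → Fin m → Fin m
power ρ i = iter (ρ ⟨$⟩ʳ_) i

Semiregular : ∀ {m} → Permutation′ m → Set
Semiregular {m} ρ = ∀ i (v : Fin m) → power ρ i v ≡ v → ∀ w → power ρ i w ≡ w

SameOrbit : ∀ {m} → Permutation′ m → Fin m → Fin m → Set
SameOrbit ρ u v = ∃[ i ] power ρ i u ≡ v

HasOrbits : ∀ {m} → Permutation′ m → ℕ → Set
HasOrbits {m} ρ k =
  Σ (Fin k → Fin m) λ r →
    (∀ v → ∃[ j ] SameOrbit ρ (r j) v) ×
    (∀ j j' → SameOrbit ρ (r j) (r j') → j ≡ j')

Circulant : ℕ → Graph → Set
Circulant k G =
  Σ (Permutation′ (n G)) λ ρ → IsAut G ρ × Semiregular ρ × HasOrbits ρ k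

-- For m ≥ 1 and a = i + 2 put ν = a² - a + 1, M = m ν and Γ = ℤ_m × ℤ_M.  The
-- graph X(m, i) has a white and a black copy of Γ, white x being joined to
-- black y when y - x ∈ S = {(0,0), (0,1), (1,1-a)}.  It is cubic since the
-- three elements of S are distinct; connected since the differences (0,1) and
-- (1,-a) of elements of S generate Γ; arc-transitive since translations, the
-- colour-swapping reflection v ↦ -v and the rotation (white v ↦ white ω v,
-- black v ↦ black (ω v + (0,1))) move the base arc onto every arc, where
-- ω(x, y) = (y + (a-1)x, -ay - νx) satisfies ω² + ω + 1 = 0; and translation by
-- (0,1) is semiregular with the 2m orbits {c} × {r} × ℤ_M.  The orders 2m²ν
-- are pairwise distinct as i varies, so the graphs are pairwise non-isomorphic.

module Submission where

open import Defs hiding (sym)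
open import Data.Nat as ℕ using (ℕ; zero; suc; NonZero; _≤_)
import Data.Nat.Properties as ℕP
import Data.Nat.Divisibility as ℕD
open import Data.Nat.Divisibility using (_∣_; divides)
open import Data.Integer as ℤ using (ℤ; +_; _+_; _*_; -_; _-_; 0ℤ; 1ℤ; _%ℕ_; _/ℕ_)
import Data.Integer.Properties as ℤP
open import Data.Integer.DivMod using (n%ℕd<d; a≡a%ℕn+[a/ℕn]*n)
open import Data.Integer.Divisibility.Signed
  using (_∣?_; ∣⇒∣ᵤ; ∣m⇒∣-m; ∣m∣n⇒∣m+n; ∣n⇒∣m*n; ∣-trans; *-monoʳ-∣) renaming (_∣_ to _∣ℤ_; divides to dividesℤ)
open import Data.Integer.Tactic.RingSolver using (solve-∀)
open import Data.Fin as F using (Fin; toℕ; fromℕ<; combine; remQuot)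
import Data.Fin.Properties as FP
open import Data.Fin.Permutation using (Permutation′; _⟨$⟩ʳ_; permutation; ↔⇒≡)
open import Data.Bool using (Bool; true; false)
open import Data.Bool.Properties using (T?; T-≡)
open import Data.List using (filter; allFin; tabulate; length)
open import Data.List.Properties using (length-tabulate)
open import Data.List.Membership.Propositional using (_∈_)
open import Data.List.Membership.Propositional.Properties using (∈-filter⁺; ∈-filter⁻; ∈-tabulate⁺; ∈-tabulate⁻; ∈-allFin)
open import Data.List.Membership.Propositional.Properties.WithK using (unique∧set⇒bag)
open import Data.List.Relation.Unary.Unique.Propositional.Properties using (allFin⁺; filter⁺; tabulate⁺)
open import Data.List.Relation.Binary.BagAndSetEquality using (∼bag⇒↭)
open import Data.List.Relation.Binary.Permutation.Propositional.Properties using (↭-length)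
open import Data.Product using (Σ; ∃-syntax; _×_; _,_; proj₁; proj₂)
open import Relation.Binary.Definitions using (tri<; tri≈; tri>)
open import Data.Empty using (⊥; ⊥-elim)
open import Function using (_$_)
open import Function.Bundles using (_⇔_; mk⇔; Equivalence)
open import Relation.Binary.Structures using (IsEquivalence)
open import Relation.Binary.PropositionalEquality
open import Relation.Nullary using (¬_; Dec; yes; no)
open import Relation.Nullary.Decidable as Dec using (isYes)

multiple-below⇒0 : ∀ {d n} → d ℕD.∣ n → n ℕ.< d → n ≡ 0
multiple-below⇒0 {n = zero} _ _ = refl
multiple-below⇒0 {n = suc n} d∣n n<d = ⊥-elim (ℕP.<⇒≱ n<d (ℕD.∣⇒≤ d∣n))

module Congruence (d : ℕ) .{{_ : NonZero d}} where

  -- wrapped in a record so that x and y stay inferable from x ≋ y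
  infix 4 _≋_
  record _≋_ (x y : ℤ) : Set where
    constructor mod-intro
    field mod-divides : + d ∣ℤ x - y
  open _≋_

  private
    divides-resp : ∀ {u v} → u ≡ v → + d ∣ℤ u → + d ∣ℤ v
    divides-resp = subst (+ d ∣ℤ_)

  ≋-refl : ∀ {x} → x ≋ x
  ≋-refl {x} = mod-intro $ dividesℤ 0ℤ (trans (ℤP.+-inverseʳ x) (sym (ℤP.*-zeroˡ (+ d))))

  ≋-sym : ∀ {x y} → x ≋ y → y ≋ x
  ≋-sym {x} {y} (mod-intro p) = mod-intro (divides-resp (flip-difference x y) (∣m⇒∣-m p))
    where
    flip-difference : ∀ x y → - (x - y) ≡ y - x
    flip-difference = solve-∀

  ≋-trans : ∀ {x y z} → x ≋ y → y ≋ z → x ≋ z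
  ≋-trans {x} {y} {z} (mod-intro p) (mod-intro q) = mod-intro $ divides-resp (telescope x y z) (∣m∣n⇒∣m+n p q)
    where
    telescope : ∀ x y z → (x - y) + (y - z) ≡ x - z
    telescope = solve-∀

  +-cong : ∀ {x x′ y y′} → x ≋ x′ → y ≋ y′ → x + y ≋ x′ + y′
  +-cong {x} {x′} {y} {y′} (mod-intro p) (mod-intro q) = mod-intro $ divides-resp (regroup x x′ y y′) (∣m∣n⇒∣m+n p q)
    where
    regroup : ∀ x x′ y y′ → (x - x′) + (y - y′) ≡ (x + y) - (x′ + y′)
    regroup = solve-∀

  neg-cong : ∀ {x x′} → x ≋ x′ → - x ≋ - x′
  neg-cong {x} {x′} (mod-intro p) = mod-intro (divides-resp (negate x x′) (∣m⇒∣-m p))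
    where
    negate : ∀ x x′ → - (x - x′) ≡ - x - - x′
    negate = solve-∀

  *-congˡ : ∀ c {x x′} → x ≋ x′ → c * x ≋ c * x′
  *-congˡ c {x} {x′} (mod-intro p) = mod-intro (divides-resp (distribute c x x′) (∣n⇒∣m*n c p))
    where
    distribute : ∀ c x x′ → c * (x - x′) ≡ c * x - c * x′
    distribute = solve-∀

  +-multiple : ∀ x t → x + t * + d ≋ x
  +-multiple x t = mod-intro $ dividesℤ t (cancel x t (+ d))
    where
    cancel : ∀ x t d → (x + t * d) - x ≡ t * d
    cancel = solve-∀

  difference-≋0 : ∀ {x y} → x ≋ y → x - y ≋ 0ℤ
  difference-≋0 {x} {y} (mod-intro p) = mod-intro (divides-resp (sym (ℤP.+-identityʳ (x - y))) p)

  _≋?_ : ∀ x y → Dec (x ≋ y)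
  x ≋? y = Dec.map′ mod-intro mod-divides (+ d ∣? (x - y))

  residue-unique : ∀ {r r′} → r ℕ.< d → r′ ℕ.< d → + r ≋ + r′ → r ≡ r′
  residue-unique {r} {r′} r<d r′<d r≋r′ =
    ℤP.+-injective (ℤP.i-j≡0⇒i≡j (+ r) (+ r′) (ℤP.∣i∣≡0⇒i≡0 (multiple-below⇒0 d∣∣r-r′∣ ∣r-r′∣<d)))
    where
    d∣∣r-r′∣ : d ℕD.∣ ℤ.∣ + r - + r′ ∣
    d∣∣r-r′∣ = ∣⇒∣ᵤ (mod-divides r≋r′)
    ∣r-r′∣<d : ℤ.∣ + r - + r′ ∣ ℕ.< d
    ∣r-r′∣<d = ℕP.≤-<-trans (subst (ℕ._≤ r ℕ.⊔ r′) (cong ℤ.∣_∣ (sym (ℤP.[+m]-[+n]≡m⊖n r r′))) (ℤP.∣m⊝n∣≤m⊔n r r′))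
                            (ℕP.⊔-lub r<d r′<d)

  residue : ℤ → Fin d
  residue x = fromℕ< (n%ℕd<d x d)

  residue-sound : ∀ x → + toℕ (residue x) ≋ x
  residue-sound x rewrite FP.toℕ-fromℕ< (n%ℕd<d x d) =
    ≋-sym (subst (_≋ + (x %ℕ d)) (sym (a≡a%ℕn+[a/ℕn]*n x d)) (+-multiple (+ (x %ℕ d)) (x /ℕ d)))

  residue-resp : ∀ {x y} → x ≋ y → residue x ≡ residue y
  residue-resp {x} {y} x≋y = FP.toℕ-injective (residue-unique (FP.toℕ<n (residue x)) (FP.toℕ<n (residue y))
    (≋-trans (residue-sound x) (≋-trans x≋y (≋-sym (residue-sound y)))))

  residue-of-Fin : ∀ (i : Fin d) → residue (+ toℕ i) ≡ i
  residue-of-Fin i = FP.toℕ-injective (residue-unique (FP.toℕ<n (residue (+ toℕ i))) (FP.toℕ<n i) (residue-sound (+ toℕ i)))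

filter-length-exactly : ∀ {N k} (b : Fin N → Bool) (e : Fin k → Fin N) →
  (∀ {i j} → e i ≡ e j → i ≡ j) → (∀ w → b w ≡ true ⇔ (∃[ i ] w ≡ e i)) →
  length (filter (λ w → T? (b w)) (allFin N)) ≡ k
filter-length-exactly {N} b e e-injective selects = trans
  (↭-length (∼bag⇒↭ (unique∧set⇒bag (filter⁺ _ (allFin⁺ N)) (tabulate⁺ e-injective) same-members)))
  (length-tabulate e)
  where
  same-members : ∀ {w} → (w ∈ filter (λ w → T? (b w)) (allFin N)) ⇔ (w ∈ tabulate e)
  same-members {w} = mk⇔
    (λ w∈ → let i , w≡ei = Equivalence.to (selects w) (Equivalence.to T-≡ (proj₂ (∈-filter⁻ (λ w → T? (b w)) {xs = allFin N} w∈)))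
            in subst (λ v → v ∈ tabulate e) (sym w≡ei) (∈-tabulate⁺ _))
    (λ w∈ → ∈-filter⁺ (λ w → T? (b w)) {xs = allFin N} (∈-allFin w) (Equivalence.from T-≡ (Equivalence.from (selects w) (∈-tabulate⁻ w∈))))

_++ʷ_ : ∀ {G : Graph} {u v w} → Walk G u v → Walk G v w → Walk G u w
here       ++ʷ q = q
step e p   ++ʷ q = step e (p ++ʷ q)

reverseʷ : ∀ {G : Graph} {u v} → Walk G u v → Walk G v u
reverseʷ here = here
reverseʷ {G} (step {u} {v} e p) = reverseʷ p ++ʷ step (trans (Graph.sym G v u) e) here

isomorphic⇒same-order : ∀ {G H} → Isomorphic G H → n G ≡ n H
isomorphic⇒same-order (σ , _) = ↔⇒≡ σ

connected-from : ∀ {G : Graph} v₀ → (∀ u → Walk G v₀ u) → Connected G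
connected-from v₀ reach u v = reverseʷ (reach u) ++ʷ reach v

record GraphPresentation : Set₁ where
  field
    Point         : Set
    _≈_           : Point → Point → Set
    ≈-equivalence : IsEquivalence _≈_
    R             : Point → Point → Set
    R?            : ∀ p q → Dec (R p q)
    R-sym         : ∀ {p q} → R p q → R q p
    R-irrefl      : ∀ {p} → ¬ R p p
    R-resp        : ∀ {p p′ q q′} → p ≈ p′ → q ≈ q′ → R p q → R p′ q′
    size          : ℕ
    encode        : Point → Fin size
    decode        : Fin size → Point
    encode-resp   : ∀ {p q} → p ≈ q → encode p ≡ encode q
    decode-encode : ∀ p → decode (encode p) ≈ p
    encode-decode : ∀ u → encode (decode u) ≡ u

module Presented (𝒫 : GraphPresentation) where
  open GraphPresentation 𝒫
  open IsEquivalence ≈-equivalence renaming (refl to ≈-refl; sym to ≈-sym; trans to ≈-trans)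

  encode-injective : ∀ {p q} → encode p ≡ encode q → p ≈ q
  encode-injective {p} {q} eq =
    ≈-trans (≈-sym (decode-encode p)) (subst (λ u → decode u ≈ q) (sym eq) (decode-encode q))

  private
    isYes-⇔ : ∀ {A B : Set} (a : Dec A) (b : Dec B) → (A → B) → (B → A) → isYes a ≡ isYes b
    isYes-⇔ (yes _) (yes _) _ _ = refl
    isYes-⇔ (yes x) (no ¬y) f _ = ⊥-elim (¬y (f x))
    isYes-⇔ (no ¬x) (yes y) _ g = ⊥-elim (¬x (g y))
    isYes-⇔ (no _)  (no _)  _ _ = refl

    isYes-irrefl : ∀ p → isYes (R? p p) ≡ false
    isYes-irrefl p with R? p p
    ... | yes r = ⊥-elim (R-irrefl r)
    ... | no _  = refl

  graph : Graph
  graph = record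
    { n     = size
    ; adj   = λ u v → isYes (R? (decode u) (decode v))
    ; sym   = λ u v → isYes-⇔ (R? _ _) (R? _ _) R-sym R-sym
    ; irref = λ v → isYes-irrefl (decode v)
    }

  adj⇒R : ∀ {u v} → adj graph u v ≡ true → R (decode u) (decode v)
  adj⇒R {u} {v} h with R? (decode u) (decode v)
  ... | yes r = r

  R⇒adj : ∀ {p q} → R p q → adj graph (encode p) (encode q) ≡ true
  R⇒adj {p} {q} r with R? (decode (encode p)) (decode (encode q))
  ... | yes _ = refl
  ... | no ¬r = ⊥-elim (¬r (R-resp (≈-sym (decode-encode p)) (≈-sym (decode-encode q)) r))

  record Automorphism : Set where
    field
      to from   : Point → Point
      to-cong   : ∀ {p q} → p ≈ q → to p ≈ to q
      from-cong : ∀ {p q} → p ≈ q → from p ≈ from q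
      from-to   : ∀ p → from (to p) ≈ p
      to-from   : ∀ p → to (from p) ≈ p
      to-R      : ∀ {p q} → R p q → R (to p) (to q)
      from-R    : ∀ {p q} → R p q → R (from p) (from q)
  open Automorphism

  idᴬ : Automorphism
  idᴬ = record
    { to = λ p → p ; from = λ p → p ; to-cong = λ e → e ; from-cong = λ e → e
    ; from-to = λ _ → ≈-refl ; to-from = λ _ → ≈-refl ; to-R = λ r → r ; from-R = λ r → r }

  _∘ᴬ_ : Automorphism → Automorphism → Automorphism
  A ∘ᴬ B = record
    { to        = λ p → to A (to B p)
    ; from      = λ p → from B (from A p)
    ; to-cong   = λ e → to-cong A (to-cong B e)
    ; from-cong = λ e → from-cong B (from-cong A e)
    ; from-to   = λ p → ≈-trans (from-cong B (from-to A (to B p))) (from-to B p)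
    ; to-from   = λ p → ≈-trans (to-cong A (to-from B (from A p))) (to-from A p)
    ; to-R      = λ r → to-R A (to-R B r)
    ; from-R    = λ r → from-R B (from-R A r)
    }

  _⁻¹ᴬ : Automorphism → Automorphism
  A ⁻¹ᴬ = record
    { to = from A ; from = to A ; to-cong = from-cong A ; from-cong = to-cong A
    ; from-to = to-from A ; to-from = from-to A ; to-R = from-R A ; from-R = to-R A }

  private
    liftFun : Automorphism → Fin size → Fin size
    liftFun A u = encode (to A (decode u))

    liftFun-inverse : ∀ A u → liftFun A (liftFun (A ⁻¹ᴬ) u) ≡ u
    liftFun-inverse A u = trans (encode-resp (≈-trans (to-cong A (decode-encode _)) (to-from A _))) (encode-decode u)

  lift : Automorphism → Permutation′ size
  lift A = permutation (liftFun A) (liftFun (A ⁻¹ᴬ)) (liftFun-inverse A) (liftFun-inverse (A ⁻¹ᴬ))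

  lift-encode : ∀ A p → lift A ⟨$⟩ʳ encode p ≡ encode (to A p)
  lift-encode A p = encode-resp (to-cong A (decode-encode p))

  lift-isAut : ∀ A → IsAut graph (lift A)
  lift-isAut A u v = isYes-⇔ (R? _ _) (R? _ _)
    (λ r → R-resp (from-to A _) (from-to A _) (from-R A (R-resp (decode-encode _) (decode-encode _) r)))
    (λ r → R-resp (≈-sym (decode-encode _)) (≈-sym (decode-encode _)) (to-R A r))

  lift-power : ∀ A i p → power (lift A) i (encode p) ≡ encode (iter (to A) i p)
  lift-power A zero    p = refl
  lift-power A (suc i) p = trans (cong (lift A ⟨$⟩ʳ_) (lift-power A i p)) (lift-encode A _)

  -- If every arc (p , q) is the image of one base arc (p₀ , q₀), then the
  -- graph is arc-transitive: send (u , v) back to the base arc, then onwards.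
  arc-transitive-from : ∀ p₀ q₀ →
    (∀ {p q} → R p q → Σ Automorphism λ A → (to A p₀ ≈ p) × (to A q₀ ≈ q)) →
    ArcTransitive graph
  arc-transitive-from p₀ q₀ reach u v x y uv xy
    with reach (adj⇒R {u} {v} uv) | reach (adj⇒R {x} {y} xy)
  ... | A , Ap₀ , Aq₀ | B , Bp₀ , Bq₀ =
    lift C , lift-isAut C , moves Ap₀ Bp₀ , moves Aq₀ Bq₀
    where
    C : Automorphism
    C = B ∘ᴬ (A ⁻¹ᴬ)
    moves : ∀ {b s t} → to A b ≈ decode s → to B b ≈ decode t → lift C ⟨$⟩ʳ s ≡ t
    moves {b} {s} {t} As Bt = trans
      (encode-resp (≈-trans (to-cong B (≈-trans (from-cong A (≈-sym As)) (from-to A b))) Bt))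
      (encode-decode t)

  edge : ∀ {p q} → R p q → Walk graph (encode p) (encode q)
  edge r = step (R⇒adj r) here

  walk-resp : ∀ {u p q} → p ≈ q → Walk graph u (encode p) → Walk graph u (encode q)
  walk-resp {u} p≈q = subst (Walk graph u) (encode-resp p≈q)

  regular : ∀ {k} (nbr : Point → Fin k → Point) →
    (∀ p i → R p (nbr p i)) → (∀ p {i j} → nbr p i ≈ nbr p j → i ≡ j) →
    (∀ {p q} → R p q → ∃[ i ] q ≈ nbr p i) →
    ∀ v → length (neighbours graph v) ≡ k
  regular nbr adjacent distinct complete v =
    filter-length-exactly (adj graph v) (λ i → encode (nbr (decode v) i))
      (λ eq → distinct (decode v) (encode-injective eq)) selects
    where
    selects : ∀ w → adj graph v w ≡ true ⇔ (∃[ i ] w ≡ encode (nbr (decode v) i))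
    selects w = mk⇔
      (λ vw → let i , w≈ = complete (adj⇒R {v} {w} vw)
              in i , trans (sym (encode-decode w)) (encode-resp w≈))
      (λ { (i , refl) → subst (λ u → adj graph u (encode (nbr (decode v) i)) ≡ true) (encode-decode v)
                              (R⇒adj (adjacent (decode v) i)) })

-- ν = a² - a + 1 for a = i + 2, as a natural number i² + 3i + 3
νℕ : ℕ → ℕ
νℕ i = 3 ℕ.+ (i ℕ.* i ℕ.+ 3 ℕ.* i)

νℕ-increasing : ∀ {i j} → i ℕ.< j → νℕ i ℕ.< νℕ j
νℕ-increasing i<j = ℕP.+-monoʳ-< 3 (ℕP.+-mono-< (ℕP.*-mono-< i<j i<j) (ℕP.*-monoʳ-< 3 i<j))

νℕ-injective : ∀ i j → νℕ i ≡ νℕ j → i ≡ j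
νℕ-injective i j eq with ℕP.<-cmp i j
... | tri< i<j _ _ = ⊥-elim (ℕP.<-irrefl eq (νℕ-increasing i<j))
... | tri≈ _ i≡j _ = i≡j
... | tri> _ _ j<i = ⊥-elim (ℕP.<-irrefl (sym eq) (νℕ-increasing j<i))

module HaarModel (m : ℕ) .{{_ : NonZero m}} (i : ℕ) where

  a : ℤ
  a = + (2 ℕ.+ i)

  ν : ℤ
  ν = a * a - a + 1ℤ

  N : ℕ
  N = νℕ i

  N≡ν : + N ≡ ν
  N≡ν = begin
    + (3 ℕ.+ (i ℕ.* i ℕ.+ 3 ℕ.* i))         ≡⟨ ℤP.pos-+ 3 _ ⟩
    + 3 + + (i ℕ.* i ℕ.+ 3 ℕ.* i)           ≡⟨ cong (_+_ (+ 3)) (ℤP.pos-+ (i ℕ.* i) _) ⟩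
    + 3 + (+ (i ℕ.* i) + + (3 ℕ.* i))       ≡⟨ cong₂ (λ u v → + 3 + (u + v)) (ℤP.pos-* i i) (ℤP.pos-* 3 i) ⟩
    + 3 + (+ i * + i + + 3 * + i)           ≡⟨ expand (+ i) ⟩
    ν                                       ∎
    where
    open ≡-Reasoning
    expand : ∀ j → + 3 + (j * j + + 3 * j) ≡ (+ 2 + j) * (+ 2 + j) - (+ 2 + j) + 1ℤ
    expand = solve-∀

  M : ℕ
  M = m ℕ.* N

  instance
    M-nonZero : NonZero M
    M-nonZero = ℕP.m*n≢0 m N

  M≡mν : + M ≡ + m * ν
  M≡mν = trans (ℤP.pos-* m N) (cong (+ m *_) N≡ν)

  module Mod₁ = Congruence m
  module Mod₂ = Congruence M
  open Mod₁ using () renaming (_≋_ to _≋₁_)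
  open Mod₂ using () renaming (_≋_ to _≋₂_)

  ≋₂⇒≋₁ : ∀ {x y} → x ≋₂ y → x ≋₁ y
  ≋₂⇒≋₁ (Mod₂.mod-intro M∣) = Mod₁.mod-intro (∣-trans m∣M M∣)
    where
    m∣M : + m ∣ℤ + M
    m∣M = dividesℤ (+ N) (trans (ℤP.pos-* m N) (ℤP.*-comm (+ m) (+ N)))

  ≋₁⇒ν≋₂ : ∀ {x y} → x ≋₁ y → ν * x ≋₂ ν * y
  ≋₁⇒ν≋₂ {x} {y} (Mod₁.mod-intro m∣) =
    Mod₂.mod-intro (subst₂ _∣ℤ_ (trans (ℤP.*-comm ν (+ m)) (sym M≡mν)) (distribute ν x y) (*-monoʳ-∣ ν m∣))
    where
    distribute : ∀ c x y → c * (x - y) ≡ c * x - c * y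
    distribute = solve-∀

  -- Γ = ℤ_m × ℤ_M, represented by ℤ × ℤ up to the congruence _≈_
  Γ : Set
  Γ = ℤ × ℤ

  infixl 6 _⊕_ _⊖_
  _⊕_ _⊖_ : Γ → Γ → Γ
  u ⊕ v = (proj₁ u + proj₁ v , proj₂ u + proj₂ v)
  u ⊖ v = (proj₁ u - proj₁ v , proj₂ u - proj₂ v)

  ⊝_ : Γ → Γ
  ⊝ v = (- proj₁ v , - proj₂ v)

  _·_ : ℕ → Γ → Γ
  k · d = (+ k * proj₁ d , + k * proj₂ d)

  infix 4 _≈_
  record _≈_ (u v : Γ) : Set where
    constructor _,_
    field
      first  : proj₁ u ≋₁ proj₁ v
      second : proj₂ u ≋₂ proj₂ v

  ≈-isEquivalence : IsEquivalence _≈_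
  ≈-isEquivalence = record
    { refl  = Mod₁.≋-refl , Mod₂.≋-refl
    ; sym   = λ (p , q) → Mod₁.≋-sym p , Mod₂.≋-sym q
    ; trans = λ (p , q) (p′ , q′) → Mod₁.≋-trans p p′ , Mod₂.≋-trans q q′
    }
  open IsEquivalence ≈-isEquivalence public
    using () renaming (refl to ≈-refl; sym to ≈-sym; trans to ≈-trans)

  ≈-reflexive : ∀ {u v} → u ≡ v → u ≈ v
  ≈-reflexive refl = ≈-refl

  _≈?_ : ∀ u v → Dec (u ≈ v)
  u ≈? v with proj₁ u Mod₁.≋? proj₁ v | proj₂ u Mod₂.≋? proj₂ v
  ... | yes p | yes q = yes (p , q)
  ... | no ¬p | _     = no (λ e → ¬p (_≈_.first e))
  ... | _     | no ¬q = no (λ e → ¬q (_≈_.second e))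

  ⊕-cong : ∀ {u u′ v v′} → u ≈ u′ → v ≈ v′ → u ⊕ v ≈ u′ ⊕ v′
  ⊕-cong (p , q) (p′ , q′) = Mod₁.+-cong p p′ , Mod₂.+-cong q q′

  ⊕-congˡ : ∀ t {u v} → u ≈ v → t ⊕ u ≈ t ⊕ v
  ⊕-congˡ t = ⊕-cong {t} ≈-refl

  ⊝-cong : ∀ {u u′} → u ≈ u′ → ⊝ u ≈ ⊝ u′
  ⊝-cong (p , q) = Mod₁.neg-cong p , Mod₂.neg-cong q

  ⊖-cong : ∀ {u u′ v v′} → u ≈ u′ → v ≈ v′ → u ⊖ v ≈ u′ ⊖ v′
  ⊖-cong p q = ⊕-cong p (⊝-cong q)

  cancelˡ : ∀ u v → (u ⊕ v) ⊖ u ≡ v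
  cancelˡ u v = cong₂ _,_ (law (proj₁ u) (proj₁ v)) (law (proj₂ u) (proj₂ v))
    where
    law : ∀ x y → (x + y) - x ≡ y
    law = solve-∀

  sub-sub : ∀ u v → u ⊖ (u ⊖ v) ≡ v
  sub-sub u v = cong₂ _,_ (law (proj₁ u) (proj₁ v)) (law (proj₂ u) (proj₂ v))
    where
    law : ∀ x y → x - (x - y) ≡ y
    law = solve-∀

  add-sub : ∀ u v → u ⊕ (v ⊖ u) ≡ v
  add-sub u v = cong₂ _,_ (law (proj₁ u) (proj₁ v)) (law (proj₂ u) (proj₂ v))
    where
    law : ∀ x y → x + (y - x) ≡ y
    law = solve-∀

  translate-difference : ∀ u v t → (t ⊕ v) ⊖ (t ⊕ u) ≡ v ⊖ u
  translate-difference u v t = cong₂ _,_ (law (proj₁ u) (proj₁ v) (proj₁ t)) (law (proj₂ u) (proj₂ v) (proj₂ t))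
    where
    law : ∀ x y z → (z + y) - (z + x) ≡ y - x
    law = solve-∀

  negate-difference : ∀ u v → (⊝ u) ⊖ (⊝ v) ≡ v ⊖ u
  negate-difference u v = cong₂ _,_ (law (proj₁ u) (proj₁ v)) (law (proj₂ u) (proj₂ v))
    where
    law : ∀ x y → - x - - y ≡ y - x
    law = solve-∀

  ⊝-involutive : ∀ v → ⊝ ⊝ v ≡ v
  ⊝-involutive v = cong₂ _,_ (ℤP.neg-involutive (proj₁ v)) (ℤP.neg-involutive (proj₂ v))

  -- The linear map ω(x, y) = (y + (a-1)x, -ay - νx) of Γ.  Its matrix has
  -- trace -1 and determinant 1, so ω² + ω + 1 = 0 and ω³ = 1.
  ω : Γ → Γ
  ω v = (proj₂ v + (a - 1ℤ) * proj₁ v , - (a * proj₂ v) - ν * proj₁ v)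

  -- ω is well defined on ℤ_m × ℤ_M because m ∣ M and M = m ν
  ω-cong : ∀ {u v} → u ≈ v → ω u ≈ ω v
  ω-cong (p , q) =
    Mod₁.+-cong (≋₂⇒≋₁ q) (Mod₁.*-congˡ (a - 1ℤ) p) ,
    Mod₂.+-cong (Mod₂.neg-cong (Mod₂.*-congˡ a q)) (Mod₂.neg-cong (≋₁⇒ν≋₂ p))

  ω-⊕ : ∀ u v → ω (u ⊕ v) ≡ ω u ⊕ ω v
  ω-⊕ (x₁ , y₁) (x₂ , y₂) = cong₂ _,_ (first (a - 1ℤ) x₁ y₁ x₂ y₂) (second a ν x₁ y₁ x₂ y₂)
    where
    first : ∀ c x₁ y₁ x₂ y₂ → (y₁ + y₂) + c * (x₁ + x₂) ≡ (y₁ + c * x₁) + (y₂ + c * x₂)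
    first = solve-∀
    second : ∀ a n x₁ y₁ x₂ y₂ →
      - (a * (y₁ + y₂)) - n * (x₁ + x₂) ≡ (- (a * y₁) - n * x₁) + (- (a * y₂) - n * x₂)
    second = solve-∀

  ω-⊝ : ∀ v → ω (⊝ v) ≡ ⊝ ω v
  ω-⊝ (x , y) = cong₂ _,_ (first (a - 1ℤ) x y) (second a ν x y)
    where
    first : ∀ c x y → - y + c * - x ≡ - (y + c * x)
    first = solve-∀
    second : ∀ a n x y → - (a * - y) - n * - x ≡ - (- (a * y) - n * x)
    second = solve-∀

  ω² : ∀ v → ω (ω v) ≡ ⊝ (ω v ⊕ v)
  ω² (x , y) = cong₂ _,_ (first a x y) (second a x y)
    where
    first : ∀ a x y →
      (- (a * y) - (a * a - a + 1ℤ) * x) + (a - 1ℤ) * (y + (a - 1ℤ) * x) ≡ - ((y + (a - 1ℤ) * x) + x)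
    first = solve-∀
    second : ∀ a x y →
      - (a * (- (a * y) - (a * a - a + 1ℤ) * x)) - (a * a - a + 1ℤ) * (y + (a - 1ℤ) * x)
        ≡ - ((- (a * y) - (a * a - a + 1ℤ) * x) + y)
    second = solve-∀

  ω-cube : ∀ v → ω (ω (ω v)) ≡ v
  ω-cube v = begin
    ω (ω (ω v))              ≡⟨ cong ω (ω² v) ⟩
    ω (⊝ (ω v ⊕ v))          ≡⟨ ω-⊝ (ω v ⊕ v) ⟩
    ⊝ ω (ω v ⊕ v)            ≡⟨ cong ⊝_ (ω-⊕ (ω v) v) ⟩
    ⊝ (ω (ω v) ⊕ ω v)        ≡⟨ cong (λ w → ⊝ (w ⊕ ω v)) (ω² v) ⟩
    ⊝ (⊝ (ω v ⊕ v) ⊕ ω v)    ≡⟨ cong₂ _,_ (law (proj₁ (ω v)) (proj₁ v)) (law (proj₂ (ω v)) (proj₂ v)) ⟩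
    v                        ∎
    where
    open ≡-Reasoning
    law : ∀ x y → - (- (x + y) + x) ≡ y
    law = solve-∀

  affine-cube : ∀ t v → ω (ω (ω v ⊕ t) ⊕ t) ⊕ t ≡ v
  affine-cube t v = begin
    ω (ω (ω v ⊕ t) ⊕ t) ⊕ t                    ≡⟨ cong (λ w → ω (w ⊕ t) ⊕ t) (ω-⊕ (ω v) t) ⟩
    ω (ω (ω v) ⊕ ω t ⊕ t) ⊕ t                  ≡⟨ cong (_⊕ t) (ω-⊕ (ω (ω v) ⊕ ω t) t) ⟩
    ω (ω (ω v) ⊕ ω t) ⊕ ω t ⊕ t                ≡⟨ cong (λ w → w ⊕ ω t ⊕ t) (ω-⊕ (ω (ω v)) (ω t)) ⟩
    ω (ω (ω v)) ⊕ ω (ω t) ⊕ ω t ⊕ t            ≡⟨ cong₂ (λ w z → w ⊕ z ⊕ ω t ⊕ t) (ω-cube v) (ω² t) ⟩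
    v ⊕ ⊝ (ω t ⊕ t) ⊕ ω t ⊕ t                  ≡⟨ cong₂ _,_ (law (proj₁ v) (proj₁ (ω t)) (proj₁ t))
                                                            (law (proj₂ v) (proj₂ (ω t)) (proj₂ t)) ⟩
    v                                          ∎
    where
    open ≡-Reasoning
    law : ∀ x y z → x + - (y + z) + y + z ≡ x
    law = solve-∀

  s : Fin 3 → Γ
  s F.zero             = (0ℤ , 0ℤ)
  s (F.suc F.zero)     = (0ℤ , 1ℤ)
  s (F.suc (F.suc F.zero)) = (1ℤ , 1ℤ - a)

  next : Fin 3 → Fin 3
  next F.zero             = F.suc F.zero
  next (F.suc F.zero)     = F.suc (F.suc F.zero)
  next (F.suc (F.suc F.zero)) = F.zero

  s₁ : Γ
  s₁ = s (F.suc F.zero)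

  rotate-connection : ∀ j → ω (s j) ⊕ s₁ ≡ s (next j)
  rotate-connection F.zero = cong₂ _,_ (first a) (second a)
    where
    first : ∀ a → 0ℤ + (a - 1ℤ) * 0ℤ + 0ℤ ≡ 0ℤ
    first = solve-∀
    second : ∀ a → - (a * 0ℤ) - (a * a - a + 1ℤ) * 0ℤ + 1ℤ ≡ 1ℤ
    second = solve-∀
  rotate-connection (F.suc F.zero) = cong₂ _,_ (first a) (second a)
    where
    first : ∀ a → 1ℤ + (a - 1ℤ) * 0ℤ + 0ℤ ≡ 1ℤ
    first = solve-∀
    second : ∀ a → - (a * 1ℤ) - (a * a - a + 1ℤ) * 0ℤ + 1ℤ ≡ 1ℤ - a
    second = solve-∀
  rotate-connection (F.suc (F.suc F.zero)) = cong₂ _,_ (first a) (second a)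
    where
    first : ∀ a → (1ℤ - a) + (a - 1ℤ) * 1ℤ + 0ℤ ≡ 0ℤ
    first = solve-∀
    second : ∀ a → - (a * (1ℤ - a)) - (a * a - a + 1ℤ) * 1ℤ + 1ℤ ≡ 0ℤ
    second = solve-∀

  -- a = 2 + i is smaller than M, since M ≥ ν = i² + 3i + 3
  a<M : 2 ℕ.+ i ℕ.< M
  a<M = ℕP.<-≤-trans (ℕ.s≤s (ℕ.s≤s (ℕ.s≤s (ℕP.≤-trans (ℕP.m≤m+n i (2 ℕ.* i)) (ℕP.m≤n+m (3 ℕ.* i) (i ℕ.* i))))))
                     (ℕP.m≤n*m N m)

  nonzero-below-M : ∀ {x y r} → x ≋₂ y → x - y ≡ + suc r → suc r ℕ.< M → ⊥
  nonzero-below-M {r = r} x≋y x-y≡r r<M with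
    Mod₂.residue-unique r<M (ℕP.<-trans (ℕ.s≤s ℕ.z≤n) r<M) (subst (Mod₂._≋ 0ℤ) x-y≡r (Mod₂.difference-≋0 x≋y))
  ... | ()

  s-injective : ∀ {j k} → s j ≈ s k → j ≡ k
  s-injective {F.zero} {F.zero} _ = refl
  s-injective {F.suc F.zero} {F.suc F.zero} _ = refl
  s-injective {F.suc (F.suc F.zero)} {F.suc (F.suc F.zero)} _ = refl
  s-injective {F.zero} {F.suc F.zero} (_ , e) =
    ⊥-elim (nonzero-below-M (Mod₂.≋-sym e) refl (ℕP.<-trans (ℕ.s≤s (ℕ.s≤s ℕ.z≤n)) a<M))
  s-injective {F.zero} {F.suc (F.suc F.zero)} (_ , e) = ⊥-elim (nonzero-below-M e (gap (+ i)) (ℕP.<-trans (ℕP.n<1+n _) a<M))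
    where
    gap : ∀ j → 0ℤ - (1ℤ - (+ 2 + j)) ≡ + 1 + j
    gap = solve-∀
  s-injective {F.suc F.zero} {F.suc (F.suc F.zero)} (_ , e) = ⊥-elim (nonzero-below-M e (gap (+ i)) a<M)
    where
    gap : ∀ j → 1ℤ - (1ℤ - (+ 2 + j)) ≡ + 2 + j
    gap = solve-∀
  s-injective {F.suc F.zero} {F.zero} e = sym (s-injective (≈-sym e))
  s-injective {F.suc (F.suc F.zero)} {F.zero} e = sym (s-injective (≈-sym e))
  s-injective {F.suc (F.suc F.zero)} {F.suc F.zero} e = sym (s-injective (≈-sym e))

  data Point : Set where
    white black : Γ → Point

  infix 4 _∼_
  data _∼_ : Point → Point → Set where
    white : ∀ {u v} → u ≈ v → white u ∼ white v
    black : ∀ {u v} → u ≈ v → black u ∼ black v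

  ∼-isEquivalence : IsEquivalence _∼_
  ∼-isEquivalence = record { refl = ∼-refl ; sym = ∼-sym ; trans = ∼-trans }
    where
    ∼-refl : ∀ {p} → p ∼ p
    ∼-refl {white _} = white ≈-refl
    ∼-refl {black _} = black ≈-refl
    ∼-sym : ∀ {p q} → p ∼ q → q ∼ p
    ∼-sym (white e) = white (≈-sym e)
    ∼-sym (black e) = black (≈-sym e)
    ∼-trans : ∀ {p q r} → p ∼ q → q ∼ r → p ∼ r
    ∼-trans (white e) (white e′) = white (≈-trans e e′)
    ∼-trans (black e) (black e′) = black (≈-trans e e′)

  InS : Γ → Set
  InS d = ∃[ j ] d ≈ s j

  InS-resp : ∀ {d d′} → d ≈ d′ → InS d → InS d′
  InS-resp d≈d′ (j , d≈s) = j , ≈-trans (≈-sym d≈d′) d≈s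

  R : Point → Point → Set
  R (white x) (black y) = InS (y ⊖ x)
  R (black y) (white x) = InS (y ⊖ x)
  R (white _) (white _) = ⊥
  R (black _) (black _) = ⊥

  R? : ∀ p q → Dec (R p q)
  R? (white x) (black y) = FP.any? (λ j → (y ⊖ x) ≈? s j)
  R? (black y) (white x) = FP.any? (λ j → (y ⊖ x) ≈? s j)
  R? (white _) (white _) = no λ ()
  R? (black _) (black _) = no λ ()

  R-sym : ∀ {p q} → R p q → R q p
  R-sym {white _} {black _} r = r
  R-sym {black _} {white _} r = r

  R-irrefl : ∀ {p} → ¬ R p p
  R-irrefl {white _} ()
  R-irrefl {black _} ()

  R-resp : ∀ {p p′ q q′} → p ∼ p′ → q ∼ q′ → R p q → R p′ q′
  R-resp (white ex) (black ey) = InS-resp (⊖-cong ey ex)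
  R-resp (black ey) (white ex) = InS-resp (⊖-cong ey ex)

  point : Fin 2 → Γ → Point
  point F.zero           = white
  point (F.suc F.zero)   = black

  point-cong : ∀ c {u v} → u ≈ v → point c u ∼ point c v
  point-cong F.zero         = white
  point-cong (F.suc F.zero) = black

  index : Γ → Fin (m ℕ.* M)
  index v = combine (Mod₁.residue (proj₁ v)) (Mod₂.residue (proj₂ v))

  coords : Fin (m ℕ.* M) → Γ
  coords j = (+ toℕ (proj₁ (remQuot {m} M j)) , + toℕ (proj₂ (remQuot {m} M j)))

  index-resp : ∀ {u v} → u ≈ v → index u ≡ index v
  index-resp (p , q) = cong₂ combine (Mod₁.residue-resp p) (Mod₂.residue-resp q)

  coords-index : ∀ v → coords (index v) ≈ v
  coords-index (x , y) = subst (_≈ (x , y)) (sym coords-combine) (Mod₁.residue-sound x , Mod₂.residue-sound y)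
    where
    coords-combine : coords (index (x , y)) ≡ (+ toℕ (Mod₁.residue x) , + toℕ (Mod₂.residue y))
    coords-combine = cong (λ q → (+ toℕ (proj₁ q) , + toℕ (proj₂ q))) (FP.remQuot-combine (Mod₁.residue x) (Mod₂.residue y))

  index-coords : ∀ j → index (coords j) ≡ j
  index-coords j = trans (cong₂ combine (Mod₁.residue-of-Fin _) (Mod₂.residue-of-Fin _)) (FP.combine-remQuot {m} M j)

  size : ℕ
  size = m ℕ.* M ℕ.* 2

  encode : Point → Fin size
  encode (white v) = combine (index v) F.zero
  encode (black v) = combine (index v) (F.suc F.zero)

  cell : Fin size → Fin (m ℕ.* M)
  cell u = proj₁ (remQuot {m ℕ.* M} 2 u)

  colour : Fin size → Fin 2
  colour u = proj₂ (remQuot {m ℕ.* M} 2 u)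

  decode : Fin size → Point
  decode u = point (colour u) (coords (cell u))

  encode-point : ∀ c v → encode (point c v) ≡ combine (index v) c
  encode-point F.zero         v = refl
  encode-point (F.suc F.zero) v = refl

  decode-combine : ∀ j c → decode (combine j c) ≡ point c (coords j)
  decode-combine j c = cong (λ q → point (proj₂ q) (coords (proj₁ q))) (FP.remQuot-combine {m ℕ.* M} {2} j c)

  encode-resp : ∀ {p q} → p ∼ q → encode p ≡ encode q
  encode-resp (white e) = cong (λ j → combine j F.zero) (index-resp e)
  encode-resp (black e) = cong (λ j → combine j (F.suc F.zero)) (index-resp e)

  decode-encode : ∀ p → decode (encode p) ∼ p
  decode-encode (white v) = subst (_∼ white v) (sym (decode-combine (index v) F.zero)) (white (coords-index v))
  decode-encode (black v) = subst (_∼ black v) (sym (decode-combine (index v) (F.suc F.zero))) (black (coords-index v))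

  encode-decode : ∀ u → encode (decode u) ≡ u
  encode-decode u = begin
    encode (decode u)             ≡⟨⟩
    encode (point c (coords j))   ≡⟨ encode-point c (coords j) ⟩
    combine (index (coords j)) c  ≡⟨ cong (λ k → combine k c) (index-coords j) ⟩
    combine j c                   ≡⟨ FP.combine-remQuot {m ℕ.* M} 2 u ⟩
    u                             ∎
    where
    open ≡-Reasoning
    j : Fin (m ℕ.* M)
    j = cell u
    c : Fin 2
    c = colour u

  presentation : GraphPresentation
  presentation = record
    { Point = Point ; _≈_ = _∼_ ; ≈-equivalence = ∼-isEquivalence
    ; R = R ; R? = R? ; R-sym = R-sym ; R-irrefl = R-irrefl ; R-resp = R-resp
    ; size = size ; encode = encode ; decode = decode
    ; encode-resp = encode-resp ; decode-encode = decode-encode ; encode-decode = encode-decode }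

  open Presented presentation public using (graph)
  open Presented presentation hiding (graph)
  open Automorphism

  recolour : (Γ → Γ) → (Γ → Γ) → Point → Point
  recolour f g (white v) = white (f v)
  recolour f g (black v) = black (g v)

  translation : Γ → Automorphism
  translation t = record
    { to        = recolour (t ⊕_) (t ⊕_)
    ; from      = recolour (⊝ t ⊕_) (⊝ t ⊕_)
    ; to-cong   = λ { (white e) → white (⊕-congˡ t e) ; (black e) → black (⊕-congˡ t e) }
    ; from-cong = λ { (white e) → white (⊕-congˡ (⊝ t) e) ; (black e) → black (⊕-congˡ (⊝ t) e) }
    ; from-to   = λ { (white v) → white (back v) ; (black v) → black (back v) }
    ; to-from   = λ { (white v) → white (forth v) ; (black v) → black (forth v) }
    ; to-R      = λ {p} {q} → preserves t {p} {q}
    ; from-R    = λ {p} {q} → preserves (⊝ t) {p} {q}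
    }
    where
    back : ∀ v → ⊝ t ⊕ (t ⊕ v) ≈ v
    back v = ≈-reflexive (cong₂ _,_ (law (proj₁ t) (proj₁ v)) (law (proj₂ t) (proj₂ v)))
      where
      law : ∀ x y → - x + (x + y) ≡ y
      law = solve-∀
    forth : ∀ v → t ⊕ (⊝ t ⊕ v) ≈ v
    forth v = ≈-reflexive (cong₂ _,_ (law (proj₁ t) (proj₁ v)) (law (proj₂ t) (proj₂ v)))
      where
      law : ∀ x y → x + (- x + y) ≡ y
      law = solve-∀
    preserves : ∀ t {p q} → R p q → R (recolour (t ⊕_) (t ⊕_) p) (recolour (t ⊕_) (t ⊕_) q)
    preserves t {white x} {black y} = InS-resp (≈-reflexive (sym (translate-difference x y t)))
    preserves t {black y} {white x} = InS-resp (≈-reflexive (sym (translate-difference x y t)))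

  reflect : Point → Point
  reflect (white v) = black (⊝ v)
  reflect (black v) = white (⊝ v)

  reflection : Automorphism
  reflection = record
    { to = reflect ; from = reflect ; to-cong = reflect-cong ; from-cong = reflect-cong
    ; from-to = reflect-involutive ; to-from = reflect-involutive ; to-R = reflect-R ; from-R = reflect-R }
    where
    reflect-cong : ∀ {p q} → p ∼ q → reflect p ∼ reflect q
    reflect-cong (white e) = black (⊝-cong e)
    reflect-cong (black e) = white (⊝-cong e)
    reflect-involutive : ∀ p → reflect (reflect p) ∼ p
    reflect-involutive (white v) = white (≈-reflexive (⊝-involutive v))
    reflect-involutive (black v) = black (≈-reflexive (⊝-involutive v))
    reflect-R : ∀ {p q} → R p q → R (reflect p) (reflect q)
    reflect-R {white x} {black y} = InS-resp (≈-reflexive (sym (negate-difference x y)))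
    reflect-R {black y} {white x} = InS-resp (≈-reflexive (sym (negate-difference x y)))

  rotate : Point → Point
  rotate = recolour ω (λ v → ω v ⊕ s₁)

  ω-⊖ : ∀ u v → ω (u ⊖ v) ≡ ω u ⊖ ω v
  ω-⊖ u v = trans (ω-⊕ u (⊝ v)) (cong (ω u ⊕_) (ω-⊝ v))

  rotate-InS : ∀ x y → InS (y ⊖ x) → InS ((ω y ⊕ s₁) ⊖ ω x)
  rotate-InS x y (j , e) = next j , ≈-trans (≈-reflexive difference) (≈-trans (⊕-cong (ω-cong e) ≈-refl)
                                                                        (≈-reflexive (rotate-connection j)))
    where
    difference : (ω y ⊕ s₁) ⊖ ω x ≡ ω (y ⊖ x) ⊕ s₁
    difference = begin
      (ω y ⊕ s₁) ⊖ ω x   ≡⟨ cong₂ _,_ (law (proj₁ (ω y)) (proj₁ s₁) (proj₁ (ω x))) (law (proj₂ (ω y)) (proj₂ s₁) (proj₂ (ω x))) ⟩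
      (ω y ⊖ ω x) ⊕ s₁   ≡⟨ cong (_⊕ s₁) (sym (ω-⊖ y x)) ⟩
      ω (y ⊖ x) ⊕ s₁     ∎
      where
      open ≡-Reasoning
      law : ∀ p t q → (p + t) - q ≡ (p - q) + t
      law = solve-∀

  rotation : Automorphism
  rotation = record
    { to = rotate ; from = λ p → rotate (rotate p)
    ; to-cong = rotate-cong ; from-cong = λ e → rotate-cong (rotate-cong e)
    ; from-to = rotate-cube ; to-from = rotate-cube
    ; to-R = rotate-R ; from-R = λ r → rotate-R (rotate-R r) }
    where
    rotate-cong : ∀ {p q} → p ∼ q → rotate p ∼ rotate q
    rotate-cong (white e) = white (ω-cong e)
    rotate-cong (black e) = black (⊕-cong (ω-cong e) ≈-refl)
    rotate-cube : ∀ p → rotate (rotate (rotate p)) ∼ p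
    rotate-cube (white v) = white (≈-reflexive (ω-cube v))
    rotate-cube (black v) = black (≈-reflexive (affine-cube s₁ v))
    rotate-R : ∀ {p q} → R p q → R (rotate p) (rotate q)
    rotate-R {white x} {black y} = rotate-InS x y
    rotate-R {black y} {white x} = rotate-InS x y

  o : Γ
  o = s F.zero

  ω-origin : ω o ≡ o
  ω-origin = cong₂ _,_ (first (a - 1ℤ)) (second a ν)
    where
    first : ∀ c → 0ℤ + c * 0ℤ ≡ 0ℤ
    first = solve-∀
    second : ∀ a n → - (a * 0ℤ) - n * 0ℤ ≡ 0ℤ
    second = solve-∀

  turn : Fin 3 → Automorphism
  turn F.zero                 = idᴬ
  turn (F.suc F.zero)         = rotation
  turn (F.suc (F.suc F.zero)) = rotation ∘ᴬ rotation

  turn-white : ∀ j → to (turn j) (white o) ∼ white o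
  turn-white F.zero                 = white ≈-refl
  turn-white (F.suc F.zero)         = white (≈-reflexive ω-origin)
  turn-white (F.suc (F.suc F.zero)) = white (≈-reflexive (trans (cong ω ω-origin) ω-origin))

  turn-black : ∀ j → to (turn j) (black o) ∼ black (s j)
  turn-black F.zero                 = black ≈-refl
  turn-black (F.suc F.zero)         = black (≈-reflexive (rotate-connection F.zero))
  turn-black (F.suc (F.suc F.zero)) =
    black (≈-reflexive (trans (cong (λ v → ω v ⊕ s₁) (rotate-connection F.zero)) (rotate-connection (F.suc F.zero))))

  base-arc-reaches : ∀ {p q} → R p q → Σ Automorphism λ A → (to A (white o) ∼ p) × (to A (black o) ∼ q)
  base-arc-reaches {white x} {black y} (j , y-x≈sj) =
    translation x ∘ᴬ turn j ,
    ∼-trans (to-cong (translation x) (turn-white j)) (white (≈-reflexive x⊕o≡x)) ,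
    ∼-trans (to-cong (translation x) (turn-black j))
            (black (≈-trans (⊕-congˡ x (≈-sym y-x≈sj)) (≈-reflexive (add-sub x y))))
    where
    open IsEquivalence ∼-isEquivalence using () renaming (trans to ∼-trans)
    x⊕o≡x : x ⊕ o ≡ x
    x⊕o≡x = cong₂ _,_ (ℤP.+-identityʳ (proj₁ x)) (ℤP.+-identityʳ (proj₂ x))
  base-arc-reaches {black y} {white x} r with base-arc-reaches {white x} {black y} r
  ... | A , Ao≈x , Ao≈y = A ∘ᴬ reflection , Ao≈y , Ao≈x

  arc-transitive : ArcTransitive graph
  arc-transitive = arc-transitive-from (white o) (black o) base-arc-reaches

  hop : ∀ v j k → Walk graph (encode (white v)) (encode (white (v ⊕ (s j ⊖ s k))))
  hop v j k = walk-resp (white (≈-reflexive (regroup v (s j) (s k))))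
    (edge {white v} {black (v ⊕ s j)} (j , ≈-reflexive (cancelˡ v (s j)))
      ++ʷ edge {black (v ⊕ s j)} {white ((v ⊕ s j) ⊖ s k)} (k , ≈-reflexive (sub-sub (v ⊕ s j) (s k))))
    where
    regroup : ∀ u v w → (u ⊕ v) ⊖ w ≡ u ⊕ (v ⊖ w)
    regroup u v w = cong₂ _,_ (law (proj₁ u) (proj₁ v) (proj₁ w)) (law (proj₂ u) (proj₂ v) (proj₂ w))
      where
      law : ∀ x y z → (x + y) - z ≡ x + (y - z)
      law = solve-∀

  repeat : ∀ d → (∀ v → Walk graph (encode (white v)) (encode (white (v ⊕ d)))) →
    ∀ k v → Walk graph (encode (white v)) (encode (white (v ⊕ k · d)))
  repeat d go zero v = walk-resp (white (≈-reflexive (sym v⊕0≡v))) here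
    where
    v⊕0≡v : v ⊕ 0 · d ≡ v
    v⊕0≡v = cong₂ _,_ (ℤP.+-identityʳ (proj₁ v)) (ℤP.+-identityʳ (proj₂ v))
  repeat d go (suc k) v = repeat d go k v ++ʷ walk-resp (white (≈-reflexive once-more)) (go (v ⊕ k · d))
    where
    once-more : v ⊕ k · d ⊕ d ≡ v ⊕ suc k · d
    once-more = cong₂ _,_ (law (proj₁ v) (+ k) (proj₁ d)) (law (proj₂ v) (+ k) (proj₂ d))
      where
      law : ∀ x k e → x + k * e + e ≡ x + (1ℤ + k) * e
      law = solve-∀

  -- every white point with natural coordinates (X, Y) is reached from white o:
  -- X steps by s 2 - s 1 = (1, -a), then Y + a X steps by s 1 - s 0 = (0, 1)
  reach-white : ∀ X Y → Walk graph (encode (white o)) (encode (white (+ X , + Y)))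
  reach-white X Y = walk-resp (white (≈-reflexive arrives))
    (repeat (s two ⊖ s one) (λ v → hop v two one) X o
      ++ʷ repeat (s one ⊖ s F.zero) (λ v → hop v one F.zero) K (o ⊕ X · (s two ⊖ s one)))
    where
    one two : Fin 3
    one = F.suc F.zero
    two = F.suc (F.suc F.zero)
    K : ℕ
    K = Y ℕ.+ (2 ℕ.+ i) ℕ.* X
    K≡ : + K ≡ + Y + a * + X
    K≡ = trans (ℤP.pos-+ Y _) (cong (_+_ (+ Y)) (ℤP.pos-* (2 ℕ.+ i) X))
    first : ∀ X K → 0ℤ + X * (1ℤ - 0ℤ) + K * (0ℤ - 0ℤ) ≡ X
    first = solve-∀
    second : ∀ a X Y → 0ℤ + X * ((1ℤ - a) - 1ℤ) + (Y + a * X) * (1ℤ - 0ℤ) ≡ Y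
    second = solve-∀
    arrives : o ⊕ X · (s two ⊖ s one) ⊕ K · (s one ⊖ s F.zero) ≡ (+ X , + Y)
    arrives = cong₂ _,_ (first (+ X) (+ K))
                        (trans (cong (λ k → 0ℤ + + X * ((1ℤ - a) - 1ℤ) + k * (1ℤ - 0ℤ)) K≡) (second a (+ X) (+ Y)))

  reach-point : ∀ c X Y → Walk graph (encode (white o)) (encode (point c (+ X , + Y)))
  reach-point F.zero         X Y = reach-white X Y
  reach-point (F.suc F.zero) X Y = reach-white X Y ++ʷ edge {white v} {black v} (F.zero , ≈-reflexive v⊖v≡o)
    where
    v : Γ
    v = (+ X , + Y)
    v⊖v≡o : v ⊖ v ≡ o
    v⊖v≡o = cong₂ _,_ (ℤP.+-inverseʳ (+ X)) (ℤP.+-inverseʳ (+ Y))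

  connected : Connected graph
  connected = connected-from (encode (white o)) λ u →
    subst (Walk graph (encode (white o))) (encode-decode u)
      (reach-point (colour u) (toℕ (proj₁ (remQuot {m} M (cell u)))) (toℕ (proj₂ (remQuot {m} M (cell u)))))

  neighbour : Point → Fin 3 → Point
  neighbour (white x) j = black (x ⊕ s j)
  neighbour (black y) j = white (y ⊖ s j)

  cubic : Cubic graph
  cubic = regular neighbour adjacent distinct complete
    where
    adjacent : ∀ p j → R p (neighbour p j)
    adjacent (white x) j = j , ≈-reflexive (cancelˡ x (s j))
    adjacent (black y) j = j , ≈-reflexive (sub-sub y (s j))
    distinct : ∀ p {j k} → neighbour p j ∼ neighbour p k → j ≡ k
    distinct (white x) {j} {k} (black e) = s-injective
      (≈-trans (≈-reflexive (sym (cancelˡ x (s j)))) (≈-trans (⊖-cong e (≈-refl {x})) (≈-reflexive (cancelˡ x (s k)))))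
    distinct (black y) {j} {k} (white e) = s-injective
      (≈-trans (≈-reflexive (sym (sub-sub y (s j)))) (≈-trans (⊖-cong (≈-refl {y}) e) (≈-reflexive (sub-sub y (s k)))))
    complete : ∀ {p q} → R p q → ∃[ j ] q ∼ neighbour p j
    complete {white x} {black y} (j , e) = j , black (≈-trans (≈-reflexive (sym (add-sub x y))) (⊕-congˡ x e))
    complete {black y} {white x} (j , e) = j , white (≈-trans (≈-reflexive (sym (sub-sub y x))) (⊖-cong (≈-refl {y}) e))

  ρ : Permutation′ size
  ρ = lift (translation s₁)

  translate-point : ∀ t c v → to (translation t) (point c v) ≡ point c (t ⊕ v)
  translate-point t F.zero         v = refl
  translate-point t (F.suc F.zero) v = refl

  ρ-power : ∀ k c v → power ρ k (encode (point c v)) ≡ encode (point c (k · s₁ ⊕ v))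
  ρ-power k c v = trans (lift-power (translation s₁) k (point c v)) (cong encode (iterate k))
    where
    iterate : ∀ k → iter (to (translation s₁)) k (point c v) ≡ point c (k · s₁ ⊕ v)
    iterate zero = cong (point c) (sym (cong₂ _,_ (ℤP.+-identityˡ (proj₁ v)) (ℤP.+-identityˡ (proj₂ v))))
    iterate (suc k) = begin
      to (translation s₁) (iter (to (translation s₁)) k (point c v))  ≡⟨ cong (to (translation s₁)) (iterate k) ⟩
      to (translation s₁) (point c (k · s₁ ⊕ v))                       ≡⟨ translate-point s₁ c _ ⟩
      point c (s₁ ⊕ (k · s₁ ⊕ v))                                       ≡⟨ cong (point c) (cong₂ _,_ (law (proj₁ v) (+ k) (proj₁ s₁)) (law (proj₂ v) (+ k) (proj₂ s₁))) ⟩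
      point c (suc k · s₁ ⊕ v)                                          ∎
      where
      open ≡-Reasoning
      law : ∀ x k e → e + (k * e + x) ≡ (1ℤ + k) * e + x
      law = solve-∀

  power-decode : ∀ k u → power ρ k u ≡ encode (point (colour u) (k · s₁ ⊕ coords (cell u)))
  power-decode k u = trans (cong (power ρ k) (sym (encode-decode u))) (ρ-power k (colour u) (coords (cell u)))

  point-injective : ∀ {c c′ u v} → point c u ∼ point c′ v → c ≡ c′ × u ≈ v
  point-injective {F.zero}         {F.zero}         (white e) = refl , e
  point-injective {F.suc F.zero}   {F.suc F.zero}   (black e) = refl , e
  point-injective {F.zero}         {F.suc F.zero}   ()
  point-injective {F.suc F.zero}   {F.zero}         ()

  translation-fixes : ∀ {t v} w → t ⊕ v ≈ v → t ⊕ w ≈ w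
  translation-fixes {t} {v} w t+v≈v = ≈-trans (≈-reflexive (regroup t v w))
    (≈-trans (⊕-cong t+v≈v (≈-refl {w ⊖ v})) (≈-reflexive (add-sub v w)))
    where
    regroup : ∀ t v w → t ⊕ w ≡ (t ⊕ v) ⊕ (w ⊖ v)
    regroup t v w = cong₂ _,_ (law (proj₁ t) (proj₁ v) (proj₁ w)) (law (proj₂ t) (proj₂ v) (proj₂ w))
      where
      law : ∀ t v w → t + w ≡ (t + v) + (w - v)
      law = solve-∀

  semiregular : Semiregular ρ
  semiregular k u fixes-u w = begin
    power ρ k w                                               ≡⟨ power-decode k w ⟩
    encode (point (colour w) (k · s₁ ⊕ coords (cell w)))      ≡⟨ encode-resp (point-cong (colour w) (translation-fixes {k · s₁} (coords (cell w)) fixed)) ⟩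
    encode (decode w)                                         ≡⟨ encode-decode w ⟩
    w                                                         ∎
    where
    open ≡-Reasoning
    fixed : k · s₁ ⊕ coords (cell u) ≈ coords (cell u)
    fixed = proj₂ (point-injective {colour u} {colour u} (encode-injective (trans (sym (power-decode k u)) (trans fixes-u (sym (encode-decode u))))))

  -- The ⟨ρ⟩-orbits are the 2m sets point c ({r} × ℤ_M), r ∈ ℤ_m, c ∈ Fin 2,
  -- represented by point c (r, 0) for the vertex j = combine r c of Fin (m · 2).
  representative : Fin (m ℕ.* 2) → Fin size
  representative j = encode (point (proj₂ (remQuot {m} 2 j)) (+ toℕ (proj₁ (remQuot {m} 2 j)) , 0ℤ))

  ρ-orbit : ∀ k r c → power ρ k (encode (point c (+ r , 0ℤ))) ≡ encode (point c (+ r , + k))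
  ρ-orbit k r c = trans (ρ-power k c (+ r , 0ℤ)) (cong (λ v → encode (point c v)) (cong₂ _,_ (first (+ k) (+ r)) (second (+ k))))
    where
    first : ∀ k x → k * 0ℤ + x ≡ x
    first = solve-∀
    second : ∀ k → k * 1ℤ + 0ℤ ≡ k
    second = solve-∀

  orbits : HasOrbits ρ (m ℕ.* 2)
  orbits = representative , covers , separates
    where
    covers : ∀ u → ∃[ j ] SameOrbit ρ (representative j) u
    covers u = combine r₁ (colour u) , toℕ r₂ , (begin
      power ρ (toℕ r₂) (representative (combine r₁ (colour u)))
        ≡⟨ cong (λ q → power ρ (toℕ r₂) (encode (point (proj₂ q) (+ toℕ (proj₁ q) , 0ℤ))))
                (FP.remQuot-combine {m} {2} r₁ (colour u)) ⟩
      power ρ (toℕ r₂) (encode (point (colour u) (+ toℕ r₁ , 0ℤ)))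
        ≡⟨ ρ-orbit (toℕ r₂) (toℕ r₁) (colour u) ⟩
      encode (decode u)
        ≡⟨ encode-decode u ⟩
      u ∎)
      where
      open ≡-Reasoning
      r₁ : Fin m
      r₁ = proj₁ (remQuot {m} M (cell u))
      r₂ : Fin M
      r₂ = proj₂ (remQuot {m} M (cell u))
    separates : ∀ j j′ → SameOrbit ρ (representative j) (representative j′) → j ≡ j′
    separates j j′ (k , same) = begin
      j                   ≡⟨ sym (FP.combine-remQuot {m} 2 j) ⟩
      combine r c         ≡⟨ cong₂ combine (FP.toℕ-injective (Mod₁.residue-unique (FP.toℕ<n r) (FP.toℕ<n r′) r≋r′)) c≡c′ ⟩
      combine r′ c′       ≡⟨ FP.combine-remQuot {m} 2 j′ ⟩
      j′                  ∎
      where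
      open ≡-Reasoning
      r r′ : Fin m
      r  = proj₁ (remQuot {m} 2 j)
      r′ = proj₁ (remQuot {m} 2 j′)
      c c′ : Fin 2
      c  = proj₂ (remQuot {m} 2 j)
      c′ = proj₂ (remQuot {m} 2 j′)
      related : point c (+ toℕ r , + k) ∼ point c′ (+ toℕ r′ , 0ℤ)
      related = encode-injective (trans (sym (ρ-orbit k (toℕ r) c)) same)
      c≡c′ : c ≡ c′
      c≡c′ = proj₁ (point-injective related)
      r≋r′ : + toℕ r Mod₁.≋ + toℕ r′
      r≋r′ = _≈_.first (proj₂ (point-injective related))

  circulant : Circulant (m ℕ.* 2) graph
  circulant = ρ , lift-isAut (translation s₁) , semiregular , orbits

order-injective : ∀ m .{{_ : NonZero m}} {i j} → HaarModel.size m i ≡ HaarModel.size m j → i ≡ j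
order-injective m {i} {j} eq =
  νℕ-injective i j (ℕP.*-cancelˡ-≡ _ _ m (ℕP.*-cancelˡ-≡ _ _ m (ℕP.*-cancelʳ-≡ _ _ 2 eq)))

proposition1p2 : (k : ℕ) → 1 ≤ k → 2 ∣ k →
    Σ (ℕ → Graph) λ G →
      (∀ i → Connected (G i) × Cubic (G i) × ArcTransitive (G i) × Circulant k (G i)) ×
      (∀ i j → ¬ i ≡ j → ¬ Isomorphic (G i) (G j))
proposition1p2 .(0 ℕ.* 2) () (divides zero refl)
proposition1p2 .(suc m ℕ.* 2) _ (divides (suc m) refl) =
  X.graph , (λ i → X.connected i , X.cubic i , X.arc-transitive i , X.circulant i) , non-isomorphic
  where
  module X = HaarModel (suc m)
  non-isomorphic : ∀ i j → ¬ i ≡ j → ¬ Isomorphic (X.graph i) (X.graph j)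
  non-isomorphic i j i≢j iso = i≢j (order-injective (suc m) (isomorphic⇒same-order {X.graph i} {X.graph j} iso))
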